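{- Let $a,b,k$ be nonnegative integers with $b>a\ge k-2$. Then the caterpillars $T_{a,b}$ and $T_{a+1,b-1}$ have the same $k$-deck.
   Context: For nonnegative integers $a,b$, $T_{a,b}$ denotes the tree that is the union of three paths of lengths (numbers of edges) $1$, $a$, and $b$ having one common endpoint and otherwise disjoint; it has $a+b+2$ vertices. The $k$-deck of a graph is the multiset of its $k$-vertex induced subgraphs, each taken up to isomorphism. -}

module Defs where

open import Data.Nat using (ℕ; zero; suc; _+_; _∸_; _≡ᵇ_)
open import Data.Bool using (Bool; true; false; _∧_; _∨_)
open import Data.Fin using (Fin; zero; suc; toℕ)
open import Data.Fin.Permutation using (Permutation′; _⟨$⟩ʳ_)
open import Data.Vec using (Vec; []; _∷_; lookup)
import Data.Vec as Vec
open import Data.List using (List; []; _∷_; [_]; map; _++_; upTo)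
open import Data.Bool.ListAction using (any)
open import Data.List.Relation.Binary.Permutation.Propositional using (_↭_)
open import Data.List.Relation.Binary.Pointwise using (Pointwise)
open import Data.Product using (_×_; _,_; Σ; ∃)
open import Relation.Binary.PropositionalEquality using (_≡_)

Graph : ℕ → Set
Graph n = Fin n → Fin n → Bool

_≅_ : ∀ {k} → Graph k → Graph k → Set
_≅_ {k} G H = Σ (Permutation′ k) λ π → ∀ i j → G i j ≡ H (π ⟨$⟩ʳ i) (π ⟨$⟩ʳ j)

-- All k-element subsets of Fin n, each listed exactly once
-- (as the strictly increasing vector of its elements).
subsets : (k n : ℕ) → List (Vec (Fin n) k)
subsets zero    n       = [ [] ]
subsets (suc k) zero    = []
subsets (suc k) (suc n) =
  map (λ v → zero ∷ Vec.map suc v) (subsets k n) ++ map (Vec.map suc) (subsets (suc k) n)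

induced : ∀ {n k} → Graph n → Vec (Fin n) k → Graph k
induced G v i j = G (lookup v i) (lookup v j)

deck : ∀ {n} (k : ℕ) → Graph n → List (Graph k)
deck k G = map (induced G) (subsets k _)

-- Two graphs have the same k-deck: the two multisets agree, with each
-- subgraph taken up to isomorphism (a reordering matched pointwise by ≅).
SameDeck : ∀ {n m} (k : ℕ) → Graph n → Graph m → Set
SameDeck k G H = ∃ λ L → (deck k G ↭ L) × Pointwise _≅_ L (deck k H)

-- Tree T_{a,b}: centre 0, leaf 1 (the path of length 1),
-- path 0 - 2 - 3 - ... - (a+1) (length a),
-- path 0 - (a+2) - ... - (a+b+1) (length b).
pathEdges : ℕ → List ℕ → List (ℕ × ℕ)
pathEdges x []       = []
pathEdges x (y ∷ ys) = (x , y) ∷ pathEdges y ys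

range : ℕ → ℕ → List ℕ
range s l = map (s +_) (upTo l)

tEdges : ℕ → ℕ → List (ℕ × ℕ)
tEdges a b = (0 , 1) ∷ (pathEdges 0 (range 2 a) ++ pathEdges 0 (range (2 + a) b))

adjℕ : List (ℕ × ℕ) → ℕ → ℕ → Bool
adjℕ es u v = any (λ { (x , y) → ((x ≡ᵇ u) ∧ (y ≡ᵇ v)) ∨ ((x ≡ᵇ v) ∧ (y ≡ᵇ u)) }) es

T : (a b : ℕ) → Graph (a + b + 2)
T a b u v = adjℕ (tEdges a b) (toℕ u) (toℕ v)

-- Call {X_{r+1}, Y_r} the gap at level r of T_{a+1,b}, where X_i and Y_i are at distance i + 1 from
-- the centre, and let a ≤ b and k ≤ a + 2.  A k-subset S of T_{a+1,b} is sent to a k-subset of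
-- T_{a,b+1} with isomorphic induced subgraph.  If S avoids some gap, take the least such level r,
-- cut both legs there and swap the parts nearer the centre; no edge inside S is cut, and the image
-- avoids the gap {X_r, Y_{r+1}} of T_{a,b+1} at the same least level, which makes the map invertible.
-- Otherwise S meets all a + 1 gaps, so it cannot contain the pendant leaf together with the centre
-- or X_0; then sliding the path X_a … X_0, centre, Y_0 … one step towards Y keeps every edge inside S.
module Submission where

open import Defs
open import Data.Nat using (ℕ; zero; suc; _+_; _∸_; _≤_; _<_; z≤n; s≤s; s≤s⁻¹; _≡ᵇ_)
open import Data.Nat.Properties
open import Data.Bool using (Bool; true; false; _∧_; _∨_; not; if_then_else_) renaming (T to True)
open import Data.Bool.Properties using (∧-comm; ∨-comm; T-≡; T-∧; T-∨; ⇔→≡)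
open import Data.Fin using (Fin; zero; suc; toℕ)
open import Data.Fin.Properties using (toℕ<n; toℕ-injective; injective⇒≤)
open import Data.Fin.Permutation using (Permutation; permutation; ↔⇒≡)
open import Data.Vec as Vec using (Vec; []; _∷_; lookup)
open import Data.Vec.Properties using (lookup-map)
open import Data.List as List using (List; []; _∷_; [_]; _++_; applyUpTo)
import Data.List.Properties as List
open import Data.List.Membership.Propositional using (_∈_; lose; find)
open import Data.List.Membership.Propositional.Properties using (∈-++⁺ˡ; ∈-++⁺ʳ; ∈-++⁻; ∈-map⁺; ∈-map⁻)
open import Data.List.Membership.Propositional.Properties.WithK using (unique∧set⇒bag)
open import Data.List.Relation.Unary.Any as Any using (Any; here; there)
open import Data.List.Relation.Unary.Any.Properties using (any⁺; any⁻)
open import Data.List.Relation.Unary.Unique.Propositional using (Unique)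
import Data.List.Relation.Unary.Unique.Propositional.Properties as Unique
import Data.List.Relation.Unary.AllPairs as AllPairs
import Data.List.Relation.Unary.All as All
open import Data.List.Relation.Binary.Permutation.Propositional using (_↭_)
open import Data.List.Relation.Binary.Permutation.Propositional.Properties using (map⁺)
open import Data.List.Relation.Binary.BagAndSetEquality using (∼bag⇒↭)
open import Data.List.Relation.Binary.Pointwise as Pointwise using (Pointwise)
open import Data.Product using (Σ; _,_; proj₁; proj₂; _×_)
open import Data.Sum as Sum using (_⊎_; inj₁; inj₂)
open import Data.Empty using (⊥; ⊥-elim)
open import Data.Unit using (⊤; tt)
open import Data.Maybe as Maybe using (Maybe; just; nothing; maybe′)
open import Data.Maybe.Relation.Unary.All using (All; just; nothing)
open import Function using (_∘_)
open import Function.Definitions using (Injective)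
open import Function.Bundles using (mk⇔; Equivalence)
open import Axiom.UniquenessOfIdentityProofs.WithK using (uip)
open import Relation.Binary.PropositionalEquality hiding ([_])
open import Relation.Nullary using (¬_; Dec; yes; no; does)
open import Relation.Nullary.Decidable using (dec-true; dec-false)

data Sub : ℕ → ℕ → Set where
  ∅    : Sub 0 0
  pick : ∀ {n k} → Sub n k → Sub (suc n) (suc k)
  skip : ∀ {n k} → Sub n k → Sub (suc n) k

none : ∀ n → Sub n 0
none zero    = ∅
none (suc n) = skip (none n)

allSubs : (k n : ℕ) → List (Sub n k)
allSubs zero    n       = [ none n ]
allSubs (suc k) zero    = []
allSubs (suc k) (suc n) = List.map pick (allSubs k n) ++ List.map skip (allSubs (suc k) n)

elements : ∀ {n k} → Sub n k → Vec (Fin n) k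
elements ∅        = []
elements (pick β) = zero ∷ Vec.map suc (elements β)
elements (skip β) = Vec.map suc (elements β)

elements-none : ∀ n → elements (none n) ≡ []
elements-none zero    = refl
elements-none (suc n) = cong (Vec.map suc) (elements-none n)

subsets≡map-elements : ∀ k n → subsets k n ≡ List.map elements (allSubs k n)
subsets≡map-elements zero    n       = cong [_] (sym (elements-none n))
subsets≡map-elements (suc k) zero    = refl
subsets≡map-elements (suc k) (suc n) = begin
  List.map (λ v → zero ∷ Vec.map suc v) (subsets k n) ++ List.map (Vec.map suc) (subsets (suc k) n)
    ≡⟨ cong₂ (λ p q → List.map (λ v → zero ∷ Vec.map suc v) p ++ List.map (Vec.map suc) q)
             (subsets≡map-elements k n) (subsets≡map-elements (suc k) n) ⟩
  List.map (λ v → zero ∷ Vec.map suc v) (List.map elements (allSubs k n))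
    ++ List.map (Vec.map suc) (List.map elements (allSubs (suc k) n))
    ≡⟨ cong₂ _++_ (sym (List.map-∘ (allSubs k n))) (sym (List.map-∘ (allSubs (suc k) n))) ⟩
  List.map (elements ∘ pick) (allSubs k n) ++ List.map (elements ∘ skip) (allSubs (suc k) n)
    ≡⟨ cong₂ _++_ (List.map-∘ (allSubs k n)) (List.map-∘ (allSubs (suc k) n)) ⟩
  List.map elements (List.map pick (allSubs k n)) ++ List.map elements (List.map skip (allSubs (suc k) n))
    ≡⟨ List.map-++ elements (List.map pick (allSubs k n)) (List.map skip (allSubs (suc k) n)) ⟨
  List.map elements (allSubs (suc k) (suc n)) ∎
  where open ≡-Reasoning

none-unique : ∀ {n} (β : Sub n 0) → β ≡ none n
none-unique ∅        = refl
none-unique (skip β) = cong skip (none-unique β)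

∈-allSubs : ∀ {k n} (β : Sub n k) → β ∈ allSubs k n
∈-allSubs {zero}              β        rewrite none-unique β = here refl
∈-allSubs {suc k} {suc n}     (pick β) = ∈-++⁺ˡ (∈-map⁺ pick (∈-allSubs β))
∈-allSubs {suc k} {suc n}     (skip β) = ∈-++⁺ʳ (List.map pick (allSubs k n)) (∈-map⁺ skip (∈-allSubs β))

pick-injective : ∀ {n k} {β γ : Sub n k} → pick β ≡ pick γ → β ≡ γ
pick-injective refl = refl

skip-injective : ∀ {n k} {β γ : Sub n k} → skip β ≡ skip γ → β ≡ γ
skip-injective refl = refl

allSubs-unique : ∀ k n → Unique (allSubs k n)
allSubs-unique zero    n       = All.[] AllPairs.∷ AllPairs.[]
allSubs-unique (suc k) zero    = AllPairs.[]
allSubs-unique (suc k) (suc n) =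
  Unique.++⁺ (Unique.map⁺ pick-injective (allSubs-unique k n))
             (Unique.map⁺ skip-injective (allSubs-unique (suc k) n))
             disjoint
  where
  disjoint : ∀ {β} → β ∈ List.map pick (allSubs k n) × β ∈ List.map skip (allSubs (suc k) n) → ⊥
  disjoint (p , q) with ∈-map⁻ pick p | ∈-map⁻ skip q
  ... | _ , _ , refl | _ , _ , ()

infix 7 _∋ᵇ_

_∋ᵇ_ : ∀ {n k} → Sub n k → ℕ → Bool
∅      ∋ᵇ u     = false
pick β ∋ᵇ zero  = true
skip β ∋ᵇ zero  = false
pick β ∋ᵇ suc u = β ∋ᵇ u
skip β ∋ᵇ suc u = β ∋ᵇ u

∋ᵇ⇒< : ∀ {n k} (β : Sub n k) u → β ∋ᵇ u ≡ true → u < n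
∋ᵇ⇒< (pick β) zero    _ = s≤s z≤n
∋ᵇ⇒< (pick β) (suc u) p = s≤s (∋ᵇ⇒< β u p)
∋ᵇ⇒< (skip β) (suc u) p = s≤s (∋ᵇ⇒< β u p)

∌ᵇ-≥ : ∀ {n k} (β : Sub n k) {u} → n ≤ u → β ∋ᵇ u ≡ false
∌ᵇ-≥ ∅        _         = refl
∌ᵇ-≥ (pick β) (s≤s n≤u) = ∌ᵇ-≥ β n≤u
∌ᵇ-≥ (skip β) (s≤s n≤u) = ∌ᵇ-≥ β n≤u

Sub-ext : ∀ {n k} (β γ : Sub n k) → (∀ u → β ∋ᵇ u ≡ γ ∋ᵇ u) → β ≡ γ
Sub-ext ∅        ∅        _ = refl
Sub-ext (pick β) (pick γ) e = cong pick (Sub-ext β γ (e ∘ suc))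
Sub-ext (skip β) (skip γ) e = cong skip (Sub-ext β γ (e ∘ suc))
Sub-ext (pick β) (skip γ) e with e zero
... | ()
Sub-ext (skip β) (pick γ) e with e zero
... | ()

position : ∀ {n k} (β : Sub n k) u → β ∋ᵇ u ≡ true → Fin k
position (pick β) zero    _ = zero
position (pick β) (suc u) p = suc (position β u p)
position (skip β) (suc u) p = position β u p

position-cong : ∀ {n k} (β : Sub n k) {u u′} (e : u ≡ u′) p p′ → position β u p ≡ position β u′ p′
position-cong β refl p p′ = cong (position β _) (uip p p′)

lookup-position : ∀ {n k} (β : Sub n k) u p → toℕ (lookup (elements β) (position β u p)) ≡ u
lookup-position (pick β) zero    p = refl
lookup-position (pick β) (suc u) p =
  trans (cong toℕ (lookup-map (position β u p) suc (elements β))) (cong suc (lookup-position β u p))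
lookup-position (skip β) (suc u) p =
  trans (cong toℕ (lookup-map (position β u p) suc (elements β))) (cong suc (lookup-position β u p))

∋ᵇ-lookup : ∀ {n k} (β : Sub n k) i → β ∋ᵇ toℕ (lookup (elements β) i) ≡ true
∋ᵇ-lookup (pick β) zero    = refl
∋ᵇ-lookup (pick β) (suc i) =
  trans (cong (λ x → pick β ∋ᵇ toℕ x) (lookup-map i suc (elements β))) (∋ᵇ-lookup β i)
∋ᵇ-lookup (skip β) i       =
  trans (cong (λ x → skip β ∋ᵇ toℕ x) (lookup-map i suc (elements β))) (∋ᵇ-lookup β i)

position-lookup : ∀ {n k} (β : Sub n k) i p → position β (toℕ (lookup (elements β) i)) p ≡ i
position-lookup (pick β) zero    p = refl
position-lookup (pick β) (suc i) p =
  trans (position-cong (pick β) (cong toℕ (lookup-map i suc (elements β))) p (∋ᵇ-lookup β i))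
        (cong suc (position-lookup β i (∋ᵇ-lookup β i)))
position-lookup (skip β) i       p =
  trans (position-cong (skip β) (cong toℕ (lookup-map i suc (elements β))) p (∋ᵇ-lookup β i))
        (position-lookup β i (∋ᵇ-lookup β i))

toSub : ∀ n → (ℕ → Bool) → Σ ℕ (Sub n)
toSub zero    f = 0 , ∅
toSub (suc n) f with f 0 | toSub n (f ∘ suc)
... | true  | k , β = suc k , pick β
... | false | k , β = k , skip β

toSub-∋ᵇ : ∀ n f {u} → u < n → proj₂ (toSub n f) ∋ᵇ u ≡ f u
toSub-∋ᵇ (suc n) f {u} u<n with f 0 in f0 | toSub n (f ∘ suc) in rest
toSub-∋ᵇ (suc n) f {zero}  _         | true  | _ = sym f0
toSub-∋ᵇ (suc n) f {zero}  _         | false | _ = sym f0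
toSub-∋ᵇ (suc n) f {suc u} (s≤s u<n) | true  | _ =
  trans (cong (λ σ → proj₂ σ ∋ᵇ u) (sym rest)) (toSub-∋ᵇ n (f ∘ suc) u<n)
toSub-∋ᵇ (suc n) f {suc u} (s≤s u<n) | false | _ =
  trans (cong (λ σ → proj₂ σ ∋ᵇ u) (sym rest)) (toSub-∋ᵇ n (f ∘ suc) u<n)

∋ᵇ-subst : ∀ {n k k′} (e : k ≡ k′) (β : Sub n k) u → subst (Sub n) e β ∋ᵇ u ≡ β ∋ᵇ u
∋ᵇ-subst refl β u = refl

members⇒≤ : ∀ {n k p} (β : Sub n k) (f : Fin p → ℕ) → Injective _≡_ _≡_ f →
            (∀ i → β ∋ᵇ f i ≡ true) → p ≤ k
members⇒≤ β f f-injective ∈β = injective⇒≤ {f = λ i → position β (f i) (∈β i)} λ {i} {j} same →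
  f-injective (trans (sym (lookup-position β (f i) (∈β i)))
              (trans (cong (toℕ ∘ lookup (elements β)) same) (lookup-position β (f j) (∈β j))))

record Relabelling (m n : ℕ) : Set where
  field
    to      : ℕ → ℕ
    from    : ℕ → ℕ
    to-<    : ∀ {u} → u < m → to u < n
    from-<  : ∀ {v} → v < n → from v < m
    from-to : ∀ {u} → u < m → from (to u) ≡ u
    to-from : ∀ {v} → v < n → to (from v) ≡ v

inverse : ∀ {m n} → Relabelling m n → Relabelling n m
inverse σ = record
  { to = from ; from = to ; to-< = from-< ; from-< = to-< ; from-to = to-from ; to-from = from-to }
  where open Relabelling σ

restrict : ∀ n → (ℕ → ℕ → Bool) → Graph n
restrict n A x y = A (toℕ x) (toℕ y)

module _ {m n} (σ : Relabelling m n) where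
  open Relabelling σ

  module Positions {k k′} (β : Sub m k) (γ : Sub n k′)
                   (γ-∋ᵇ : ∀ {v} → v < n → γ ∋ᵇ v ≡ β ∋ᵇ from v) where

    elemγ : Fin k′ → ℕ
    elemγ j = toℕ (lookup (elements γ) j)

    elemβ : Fin k → ℕ
    elemβ i = toℕ (lookup (elements β) i)

    private
      elemγ-< : ∀ j → elemγ j < n
      elemγ-< j = ∋ᵇ⇒< γ _ (∋ᵇ-lookup γ j)

      elemβ-< : ∀ i → elemβ i < m
      elemβ-< i = ∋ᵇ⇒< β _ (∋ᵇ-lookup β i)

    forth : Fin k → Fin k′
    forth i = position γ (to (elemβ i))
      (trans (γ-∋ᵇ (to-< (elemβ-< i))) (trans (cong (β ∋ᵇ_) (from-to (elemβ-< i))) (∋ᵇ-lookup β i)))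

    back : Fin k′ → Fin k
    back j = position β (from (elemγ j)) (trans (sym (γ-∋ᵇ (elemγ-< j))) (∋ᵇ-lookup γ j))

    back-forth : ∀ i → back (forth i) ≡ i
    back-forth i =
      trans (position-cong β (trans (cong from (lookup-position γ _ _)) (from-to (elemβ-< i))) _ (∋ᵇ-lookup β i))
            (position-lookup β i _)

    forth-back : ∀ j → forth (back j) ≡ j
    forth-back j =
      trans (position-cong γ (trans (cong to (lookup-position β _ _)) (to-from (elemγ-< j))) _ (∋ᵇ-lookup γ j))
            (position-lookup γ j _)

    positions : Permutation k′ k
    positions = permutation back forth back-forth forth-back

    to-elem-back : ∀ j → to (elemβ (back j)) ≡ elemγ j
    to-elem-back j = trans (cong to (lookup-position β _ _)) (to-from (elemγ-< j))

  module _ {k} (β : Sub m k) where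

    private
      preimage : Σ ℕ (Sub n)
      preimage = toSub n (λ v → β ∋ᵇ from v)

      module P = Positions β (proj₂ preimage) (toSub-∋ᵇ n _)

    -- Kept abstract: only ∋ᵇ-image is used, and unfolding the transport makes type checking slow.
    abstract
      image : Sub n k
      image = subst (Sub n) (↔⇒≡ P.positions) (proj₂ preimage)

      ∋ᵇ-image : ∀ {v} → v < n → image ∋ᵇ v ≡ β ∋ᵇ from v
      ∋ᵇ-image {v} v<n = trans (∋ᵇ-subst (↔⇒≡ P.positions) (proj₂ preimage) v) (toSub-∋ᵇ n _ v<n)

    image-≅ : (A B : ℕ → ℕ → Bool) →
              (∀ {u u′} → β ∋ᵇ u ≡ true → β ∋ᵇ u′ ≡ true → B u u′ ≡ A (to u) (to u′)) →
              induced (restrict n A) (elements image) ≅ induced (restrict m B) (elements β)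
    image-≅ A B preserves = Q.positions , λ i j → sym (begin
      B (Q.elemβ (Q.back i)) (Q.elemβ (Q.back j))
        ≡⟨ preserves (∋ᵇ-lookup β (Q.back i)) (∋ᵇ-lookup β (Q.back j)) ⟩
      A (to (Q.elemβ (Q.back i))) (to (Q.elemβ (Q.back j)))
        ≡⟨ cong₂ A (Q.to-elem-back i) (Q.to-elem-back j) ⟩
      A (Q.elemγ i) (Q.elemγ j) ∎)
      where
      module Q = Positions β image ∋ᵇ-image
      open ≡-Reasoning

sameDeck-bijection : ∀ {n m k} (G : Graph n) (H : Graph m)
  (Ψ : Sub m k → Sub n k) (Φ : Sub n k → Sub m k) →
  (∀ β → Φ (Ψ β) ≡ β) → (∀ χ → Ψ (Φ χ) ≡ χ) →
  (∀ β → induced G (elements (Ψ β)) ≅ induced H (elements β)) →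
  SameDeck k G H
sameDeck-bijection {n} {m} {k} G H Ψ Φ ΦΨ ΨΦ Ψ-≅ = List.map GΨ (allSubs k m) , reorder , matched
  where
  GΨ : Sub m k → Graph k
  GΨ β = induced G (elements (Ψ β))

  Ψ-injective : ∀ {β β′} → Ψ β ≡ Ψ β′ → β ≡ β′
  Ψ-injective {β} {β′} e = trans (sym (ΦΨ β)) (trans (cong Φ e) (ΦΨ β′))

  allSubs↭ : allSubs k n ↭ List.map Ψ (allSubs k m)
  allSubs↭ = ∼bag⇒↭ (unique∧set⇒bag (allSubs-unique k n) (Unique.map⁺ Ψ-injective (allSubs-unique k m))
    (λ {χ} → mk⇔ (λ _ → subst (_∈ List.map Ψ (allSubs k m)) (ΨΦ χ) (∈-map⁺ Ψ (∈-allSubs (Φ χ))))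
                 (λ _ → ∈-allSubs χ)))

  reorder : deck k G ↭ List.map GΨ (allSubs k m)
  reorder = subst₂ _↭_
    (trans (List.map-∘ (allSubs k n)) (cong (List.map (induced G)) (sym (subsets≡map-elements k n))))
    (sym (List.map-∘ (allSubs k m)))
    (map⁺ (induced G ∘ elements) allSubs↭)

  matched : Pointwise _≅_ (List.map GΨ (allSubs k m)) (deck k H)
  matched = subst (Pointwise _≅_ (List.map GΨ (allSubs k m)))
    (trans (List.map-∘ (allSubs k m)) (cong (List.map (induced H)) (sym (subsets≡map-elements k m))))
    (Pointwise.map⁺ GΨ (induced H ∘ elements) (Pointwise.refl (Ψ-≅ _)))

module Switching {m n k} {R : Set} (σ : R → Relabelling m n)
  (ρH : Sub m k → R) (ρG : Sub n k → R)
  (ρG-image : ∀ β → ρG (image (σ (ρH β)) β) ≡ ρH β)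
  (ρH-image : ∀ χ → ρH (image (inverse (σ (ρG χ))) χ) ≡ ρG χ) where

  Ψ : Sub m k → Sub n k
  Ψ β = image (σ (ρH β)) β

  Φ : Sub n k → Sub m k
  Φ χ = image (inverse (σ (ρG χ))) χ

  ΦΨ : ∀ β → Φ (Ψ β) ≡ β
  ΦΨ β = Sub-ext _ _ ∋ᵇ-ΦΨ
    where
    open Relabelling (σ (ρH β))
    ∋ᵇ-ΦΨ : ∀ u → Φ (Ψ β) ∋ᵇ u ≡ β ∋ᵇ u
    ∋ᵇ-ΦΨ u with u <? m
    ... | no u≮m = trans (∌ᵇ-≥ (Φ (Ψ β)) (≮⇒≥ u≮m)) (sym (∌ᵇ-≥ β (≮⇒≥ u≮m)))
    ... | yes u<m = begin
      Φ (Ψ β) ∋ᵇ u                         ≡⟨ ∋ᵇ-image (inverse (σ (ρG (Ψ β)))) (Ψ β) u<m ⟩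
      Ψ β ∋ᵇ Relabelling.to (σ (ρG (Ψ β))) u ≡⟨ cong (λ r → Ψ β ∋ᵇ Relabelling.to (σ r) u) (ρG-image β) ⟩
      Ψ β ∋ᵇ to u                          ≡⟨ ∋ᵇ-image (σ (ρH β)) β (to-< u<m) ⟩
      β ∋ᵇ from (to u)                     ≡⟨ cong (β ∋ᵇ_) (from-to u<m) ⟩
      β ∋ᵇ u                               ∎
      where open ≡-Reasoning

  ΨΦ : ∀ χ → Ψ (Φ χ) ≡ χ
  ΨΦ χ = Sub-ext _ _ ∋ᵇ-ΨΦ
    where
    open Relabelling (σ (ρG χ))
    ∋ᵇ-ΨΦ : ∀ v → Ψ (Φ χ) ∋ᵇ v ≡ χ ∋ᵇ v
    ∋ᵇ-ΨΦ v with v <? n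
    ... | no v≮n = trans (∌ᵇ-≥ (Ψ (Φ χ)) (≮⇒≥ v≮n)) (sym (∌ᵇ-≥ χ (≮⇒≥ v≮n)))
    ... | yes v<n = begin
      Ψ (Φ χ) ∋ᵇ v                              ≡⟨ ∋ᵇ-image (σ (ρH (Φ χ))) (Φ χ) v<n ⟩
      Φ χ ∋ᵇ Relabelling.from (σ (ρH (Φ χ))) v ≡⟨ cong (λ r → Φ χ ∋ᵇ Relabelling.from (σ r) v) (ρH-image χ) ⟩
      Φ χ ∋ᵇ from v                             ≡⟨ ∋ᵇ-image (inverse (σ (ρG χ))) χ (from-< v<n) ⟩
      χ ∋ᵇ to (from v)                          ≡⟨ cong (χ ∋ᵇ_) (to-from v<n) ⟩
      χ ∋ᵇ v                                    ∎
      where open ≡-Reasoning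

  sameDeck : (A B : ℕ → ℕ → Bool) →
    (∀ β {u u′} → β ∋ᵇ u ≡ true → β ∋ᵇ u′ ≡ true →
       B u u′ ≡ A (Relabelling.to (σ (ρH β)) u) (Relabelling.to (σ (ρH β)) u′)) →
    SameDeck k (restrict n A) (restrict m B)
  sameDeck A B preserves =
    sameDeck-bijection (restrict n A) (restrict m B) Ψ Φ ΦΨ ΨΦ
      (λ β → image-≅ (σ (ρH β)) β A B (preserves β))

-- X i and Y j are the vertices at distance i + 1 from the centre on the legs of lengths a and b.
data Leg : Set where
  X Y : ℕ → Leg

data Vertex : Set where
  centre leaf : Vertex
  leg         : Leg → Vertex

adjLeg : Leg → Leg → Bool
adjLeg (X i) (X j) = (j ≡ᵇ suc i) ∨ (i ≡ᵇ suc j)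
adjLeg (Y i) (Y j) = (j ≡ᵇ suc i) ∨ (i ≡ᵇ suc j)
adjLeg _     _     = false

nextToCentre : Leg → Bool
nextToCentre (X zero) = true
nextToCentre (Y zero) = true
nextToCentre _        = false

adjVertex : Vertex → Vertex → Bool
adjVertex centre  leaf    = true
adjVertex leaf    centre  = true
adjVertex centre  (leg l) = nextToCentre l
adjVertex (leg l) centre  = nextToCentre l
adjVertex (leg l) (leg l′) = adjLeg l l′
adjVertex _       _       = false

adjLeg-sym : ∀ l l′ → adjLeg l l′ ≡ adjLeg l′ l
adjLeg-sym (X i) (X j) = ∨-comm (j ≡ᵇ suc i) (i ≡ᵇ suc j)
adjLeg-sym (X i) (Y j) = refl
adjLeg-sym (Y i) (X j) = refl
adjLeg-sym (Y i) (Y j) = ∨-comm (j ≡ᵇ suc i) (i ≡ᵇ suc j)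

adjLeg-flip : ∀ l₁ l₂ l₃ l₄ → adjLeg l₁ l₂ ≡ adjLeg l₃ l₄ → adjLeg l₂ l₁ ≡ adjLeg l₄ l₃
adjLeg-flip l₁ l₂ l₃ l₄ e = trans (adjLeg-sym l₂ l₁) (trans e (adjLeg-sym l₃ l₄))

adjVertex-sym : ∀ w w′ → adjVertex w w′ ≡ adjVertex w′ w
adjVertex-sym centre  centre   = refl
adjVertex-sym centre  leaf     = refl
adjVertex-sym centre  (leg l)  = refl
adjVertex-sym leaf    centre   = refl
adjVertex-sym leaf    leaf     = refl
adjVertex-sym leaf    (leg l)  = refl
adjVertex-sym (leg l) centre   = refl
adjVertex-sym (leg l) leaf     = refl
adjVertex-sym (leg l) (leg l′) = adjLeg-sym l l′

≡ᵇ-refl : ∀ i → (i ≡ᵇ i) ≡ true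
≡ᵇ-refl i = Equivalence.to T-≡ (≡⇒≡ᵇ i i refl)

shift : Leg → Leg
shift (X i) = X (suc i)
shift (Y j) = Y (suc j)

adjLeg-shiftʳ : ∀ l → adjLeg l (shift l) ≡ true
adjLeg-shiftʳ (X i) = cong (_∨ (i ≡ᵇ suc (suc i))) (≡ᵇ-refl i)
adjLeg-shiftʳ (Y j) = cong (_∨ (j ≡ᵇ suc (suc j))) (≡ᵇ-refl j)

adjLeg-consecutive : ∀ {i j} → ((j ≡ᵇ suc i) ∨ (i ≡ᵇ suc j)) ≡ true → j ≡ suc i ⊎ i ≡ suc j
adjLeg-consecutive {i} {j} adj =
  Sum.map (≡ᵇ⇒≡ j (suc i)) (≡ᵇ⇒≡ i (suc j)) (Equivalence.to T-∨ (Equivalence.from T-≡ adj))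

OnLegs : ℕ → ℕ → Leg → Set
OnLegs a b (X i) = i < a
OnLegs a b (Y j) = j < b

InTree : ℕ → ℕ → Vertex → Set
InTree a b centre  = ⊤
InTree a b leaf    = ⊤
InTree a b (leg l) = OnLegs a b l

encode : ℕ → Vertex → ℕ
encode a centre      = 0
encode a leaf        = 1
encode a (leg (X i)) = 2 + i
encode a (leg (Y j)) = 2 + (a + j)

decode : ℕ → ℕ → Vertex
decode a zero          = centre
decode a (suc zero)    = leaf
decode a (suc (suc u)) with u <? a
... | yes _ = leg (X u)
... | no  _ = leg (Y (u ∸ a))

encode-decode : ∀ a u → encode a (decode a u) ≡ u
encode-decode a zero          = refl
encode-decode a (suc zero)    = refl
encode-decode a (suc (suc u)) with u <? a
... | yes _   = refl
... | no  u≮a = cong (2 +_) (m+[n∸m]≡n (≮⇒≥ u≮a))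

decode-encode : ∀ {a b} w → InTree a b w → decode a (encode a w) ≡ w
decode-encode     centre      _   = refl
decode-encode     leaf        _   = refl
decode-encode {a} (leg (X i)) i<a with i <? a
... | yes _   = refl
... | no  i≮a = ⊥-elim (i≮a i<a)
decode-encode {a} (leg (Y j)) _   with a + j <? a
... | yes a+j<a = ⊥-elim (m+n≮m a j a+j<a)
... | no  _     = cong (leg ∘ Y) (m+n∸m≡n a j)

size≡ : ∀ a b → a + b + 2 ≡ 2 + (a + b)
size≡ a b = +-comm (a + b) 2

decode-InTree : ∀ a b {u} → u < a + b + 2 → InTree a b (decode a u)
decode-InTree a b {zero}        _ = tt
decode-InTree a b {suc zero}    _ = tt
decode-InTree a b {suc (suc u)} u<size with u <? a
... | yes u<a = u<a
... | no  u≮a = +-cancelˡ-< a (u ∸ a) b (subst (_< a + b) (sym (m+[n∸m]≡n (≮⇒≥ u≮a))) u<a+b)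
  where
  u<a+b : u < a + b
  u<a+b = ≤-pred (≤-pred (subst (3 + u ≤_) (size≡ a b) u<size))

encode-< : ∀ a b w → InTree a b w → encode a w < a + b + 2
encode-< a b w w∈ = subst (encode a w <_) (sym (size≡ a b)) (bound w w∈)
  where
  bound : ∀ w → InTree a b w → encode a w < 2 + (a + b)
  bound centre      _   = s≤s z≤n
  bound leaf        _   = s≤s (s≤s z≤n)
  bound (leg (X i)) i<a = s≤s (s≤s (≤-trans i<a (m≤m+n a b)))
  bound (leg (Y j)) j<b = s≤s (s≤s (+-monoʳ-< a j<b))

Joins : ℕ → ℕ → ℕ × ℕ → Set
Joins u v (x , y) = (x ≡ u × y ≡ v) ⊎ (x ≡ v × y ≡ u)

adjℕ-sound : ∀ es {u v} → adjℕ es u v ≡ true → Any (Joins u v) es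
adjℕ-sound es {u} {v} adj = Any.map (λ {e} → joins e) (any⁻ _ es (Equivalence.from T-≡ adj))
  where
  ≡ᵇ-pair : ∀ {x y p q} → True ((x ≡ᵇ p) ∧ (y ≡ᵇ q)) → x ≡ p × y ≡ q
  ≡ᵇ-pair {x} {y} {p} {q} t with Equivalence.to T-∧ t
  ... | tx , ty = ≡ᵇ⇒≡ x p tx , ≡ᵇ⇒≡ y q ty
  joins : ∀ e → True (((proj₁ e ≡ᵇ u) ∧ (proj₂ e ≡ᵇ v)) ∨ ((proj₁ e ≡ᵇ v) ∧ (proj₂ e ≡ᵇ u))) → Joins u v e
  joins (x , y) t = Sum.map ≡ᵇ-pair ≡ᵇ-pair (Equivalence.to T-∨ t)

adjℕ-complete : ∀ es {u v} → Any (Joins u v) es → adjℕ es u v ≡ true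
adjℕ-complete es {u} {v} joined = Equivalence.to T-≡ (any⁺ _ (Any.map (λ {e} → joins e) joined))
  where
  ≡⇒≡ᵇ-pair : ∀ {x y p q} → x ≡ p × y ≡ q → True ((x ≡ᵇ p) ∧ (y ≡ᵇ q))
  ≡⇒≡ᵇ-pair {x} {y} {p} {q} (x≡p , y≡q) = Equivalence.from T-∧ (≡⇒≡ᵇ x p x≡p , ≡⇒≡ᵇ y q y≡q)
  joins : ∀ e → Joins u v e → True (((proj₁ e ≡ᵇ u) ∧ (proj₂ e ≡ᵇ v)) ∨ ((proj₁ e ≡ᵇ v) ∧ (proj₂ e ≡ᵇ u)))
  joins (x , y) j = Equivalence.from T-∨ (Sum.map ≡⇒≡ᵇ-pair ≡⇒≡ᵇ-pair j)

interval : ℕ → ℕ → List ℕ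
interval s zero    = []
interval s (suc l) = s ∷ interval (suc s) l

map-applyUpTo≡interval : ∀ (g f : ℕ → ℕ) s l → (∀ i → g (f i) ≡ s + i) →
                         List.map g (applyUpTo f l) ≡ interval s l
map-applyUpTo≡interval g f s zero    _ = refl
map-applyUpTo≡interval g f s (suc l) e =
  cong₂ _∷_ (trans (e 0) (+-identityʳ s))
            (map-applyUpTo≡interval g (f ∘ suc) (suc s) l (λ i → trans (e (suc i)) (+-suc s i)))

range≡interval : ∀ s l → range s l ≡ interval s l
range≡interval s l = map-applyUpTo≡interval (s +_) (λ i → i) s l (λ _ → refl)

∈-pathEdges⁻ : ∀ {x s l e} → e ∈ pathEdges x (interval s l) →
               (e ≡ (x , s) × 0 < l) ⊎ (Σ ℕ λ i → suc i < l × e ≡ (s + i , suc (s + i)))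
∈-pathEdges⁻ {l = suc l} (here refl) = inj₁ (refl , s≤s z≤n)
∈-pathEdges⁻ {s = s} {l = suc l} (there e∈) with ∈-pathEdges⁻ e∈
... | inj₁ (refl , 0<l)     = inj₂ (0 , s≤s 0<l , cong₂ _,_ (sym (+-identityʳ s)) (cong suc (sym (+-identityʳ s))))
... | inj₂ (i , i<l , refl) = inj₂ (suc i , s≤s i<l , cong₂ _,_ (sym (+-suc s i)) (cong suc (sym (+-suc s i))))

first∈pathEdges : ∀ x s {l} → 0 < l → (x , s) ∈ pathEdges x (interval s l)
first∈pathEdges x s {suc l} _ = here refl

step∈pathEdges : ∀ x s {l} i → suc i < l → (s + i , suc (s + i)) ∈ pathEdges x (interval s l)
step∈pathEdges x s {suc l} zero    (s≤s 1<l) rewrite +-identityʳ s = there (first∈pathEdges s (suc s) 1<l)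
step∈pathEdges x s {suc l} (suc i) (s≤s i<l) rewrite +-suc s i      = there (step∈pathEdges s (suc s) i i<l)

module _ {a b : ℕ} where

  xPath yPath : List (ℕ × ℕ)
  xPath = pathEdges 0 (interval 2 a)
  yPath = pathEdges 0 (interval (2 + a) b)

  ∈-tEdges⁻ : ∀ {e} → e ∈ tEdges a b → e ≡ (0 , 1) ⊎ e ∈ xPath ⊎ e ∈ yPath
  ∈-tEdges⁻ (here refl) = inj₁ refl
  ∈-tEdges⁻ (there e∈) = inj₂ (Sum.map (subst (_ ∈_) (cong (pathEdges 0) (range≡interval 2 a)))
                                         (subst (_ ∈_) (cong (pathEdges 0) (range≡interval (2 + a) b)))
                                         (∈-++⁻ (pathEdges 0 (range 2 a)) e∈))

  xPath⊆tEdges : ∀ {e} → e ∈ xPath → e ∈ tEdges a b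
  xPath⊆tEdges e∈ = there (∈-++⁺ˡ (subst (_ ∈_) (cong (pathEdges 0) (sym (range≡interval 2 a))) e∈))

  yPath⊆tEdges : ∀ {e} → e ∈ yPath → e ∈ tEdges a b
  yPath⊆tEdges e∈ =
    there (∈-++⁺ʳ (pathEdges 0 (range 2 a)) (subst (_ ∈_) (cong (pathEdges 0) (sym (range≡interval (2 + a) b))) e∈))

  decode-X : ∀ {i} → i < a → decode a (2 + i) ≡ leg (X i)
  decode-X {i} i<a = decode-encode {b = b} (leg (X i)) i<a

  decode-Y : ∀ j → decode a (2 + (a + j)) ≡ leg (Y j)
  decode-Y j = decode-encode {b = suc j} (leg (Y j)) (n<1+n j)

  tEdges-sound : ∀ {e} → e ∈ tEdges a b → adjVertex (decode a (proj₁ e)) (decode a (proj₂ e)) ≡ true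
  tEdges-sound e∈ with ∈-tEdges⁻ e∈
  ... | inj₁ refl = refl
  ... | inj₂ (inj₁ e∈x) with ∈-pathEdges⁻ e∈x
  ...   | inj₁ (refl , 0<a)       = cong (adjVertex centre) (decode-X 0<a)
  ...   | inj₂ (i , 1+i<a , refl) =
    trans (cong₂ adjVertex (decode-X (<-trans (n<1+n i) 1+i<a)) (decode-X 1+i<a)) (adjLeg-shiftʳ (X i))
  tEdges-sound e∈ | inj₂ (inj₂ e∈y) with ∈-pathEdges⁻ e∈y
  ...   | inj₁ (refl , _)     =
    cong (adjVertex centre) (trans (cong (λ j → decode a (2 + j)) (sym (+-identityʳ a))) (decode-Y 0))
  ...   | inj₂ (j , _ , refl) =
    trans (cong₂ adjVertex (decode-Y j) (trans (cong (λ j → decode a (2 + j)) (sym (+-suc a j))) (decode-Y (suc j))))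
          (adjLeg-shiftʳ (Y j))

  tEdges-complete : ∀ w w′ → InTree a b w → InTree a b w′ → adjVertex w w′ ≡ true →
                    Any (Joins (encode a w) (encode a w′)) (tEdges a b)
  tEdges-complete centre leaf _ _ _ = here (inj₁ (refl , refl))
  tEdges-complete leaf centre _ _ _ = here (inj₂ (refl , refl))
  tEdges-complete centre (leg (X zero)) _ 0<a _ =
    lose (xPath⊆tEdges (first∈pathEdges 0 2 0<a)) (inj₁ (refl , refl))
  tEdges-complete (leg (X zero)) centre 0<a _ _ =
    lose (xPath⊆tEdges (first∈pathEdges 0 2 0<a)) (inj₂ (refl , refl))
  tEdges-complete centre (leg (Y zero)) _ 0<b _ =
    lose (yPath⊆tEdges (first∈pathEdges 0 (2 + a) 0<b)) (inj₁ (refl , cong (2 +_) (sym (+-identityʳ a))))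
  tEdges-complete (leg (Y zero)) centre 0<b _ _ =
    lose (yPath⊆tEdges (first∈pathEdges 0 (2 + a) 0<b)) (inj₂ (refl , cong (2 +_) (sym (+-identityʳ a))))
  tEdges-complete (leg (X i)) (leg (X j)) i<a j<a adj with adjLeg-consecutive {i} {j} adj
  ... | inj₁ refl = lose (xPath⊆tEdges (step∈pathEdges 0 2 i j<a)) (inj₁ (refl , refl))
  ... | inj₂ refl = lose (xPath⊆tEdges (step∈pathEdges 0 2 j i<a)) (inj₂ (refl , refl))
  tEdges-complete (leg (Y i)) (leg (Y j)) i<b j<b adj with adjLeg-consecutive {i} {j} adj
  ... | inj₁ refl =
    lose (yPath⊆tEdges (step∈pathEdges 0 (2 + a) i j<b)) (inj₁ (refl , cong (2 +_) (sym (+-suc a i))))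
  ... | inj₂ refl =
    lose (yPath⊆tEdges (step∈pathEdges 0 (2 + a) j i<b)) (inj₂ (refl , cong (2 +_) (sym (+-suc a j))))

  T-adjacency : ∀ w w′ → InTree a b w → InTree a b w′ →
                adjℕ (tEdges a b) (encode a w) (encode a w′) ≡ adjVertex w w′
  T-adjacency w w′ w∈ w′∈ = ⇔→≡ (mk⇔ sound (adjℕ-complete (tEdges a b) ∘ tEdges-complete w w′ w∈ w′∈))
    where
    sound : adjℕ (tEdges a b) (encode a w) (encode a w′) ≡ true → adjVertex w w′ ≡ true
    sound adj with find (adjℕ-sound (tEdges a b) adj)
    ... | _ , e∈ , inj₁ (refl , refl) =
      subst₂ (λ x y → adjVertex x y ≡ true) (decode-encode w w∈) (decode-encode w′ w′∈) (tEdges-sound e∈)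
    ... | _ , e∈ , inj₂ (refl , refl) =
      trans (adjVertex-sym w w′)
            (subst₂ (λ x y → adjVertex x y ≡ true) (decode-encode w′ w′∈) (decode-encode w w∈) (tEdges-sound e∈))

-- exchange r cuts both legs at the gap {X (suc r), Y r} and swaps the parts nearer the centre;
-- exchange-X≤ … exchange-Y≥ below give its values.
exchange : ℕ → Leg → Leg
exchange zero    (X zero)    = Y zero
exchange zero    (X (suc i)) = X i
exchange zero    (Y j)       = Y (suc j)
exchange (suc r) (X zero)    = Y zero
exchange (suc r) (Y zero)    = X zero
exchange (suc r) (X (suc i)) = shift (exchange r (X i))
exchange (suc r) (Y (suc j)) = shift (exchange r (Y j))

exchange⁻¹ : ℕ → Leg → Leg
exchange⁻¹ zero    (X i)       = X (suc i)
exchange⁻¹ zero    (Y zero)    = X zero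
exchange⁻¹ zero    (Y (suc j)) = Y j
exchange⁻¹ (suc r) (X zero)    = Y zero
exchange⁻¹ (suc r) (Y zero)    = X zero
exchange⁻¹ (suc r) (X (suc i)) = shift (exchange⁻¹ r (X i))
exchange⁻¹ (suc r) (Y (suc j)) = shift (exchange⁻¹ r (Y j))

exchange-shift : ∀ r l → exchange (suc r) (shift l) ≡ shift (exchange r l)
exchange-shift r (X i) = refl
exchange-shift r (Y j) = refl

exchange⁻¹-shift : ∀ r l → exchange⁻¹ (suc r) (shift l) ≡ shift (exchange⁻¹ r l)
exchange⁻¹-shift r (X i) = refl
exchange⁻¹-shift r (Y j) = refl

exchange⁻¹-exchange : ∀ r l → exchange⁻¹ r (exchange r l) ≡ l
exchange⁻¹-exchange zero    (X zero)    = refl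
exchange⁻¹-exchange zero    (X (suc i)) = refl
exchange⁻¹-exchange zero    (Y j)       = refl
exchange⁻¹-exchange (suc r) (X zero)    = refl
exchange⁻¹-exchange (suc r) (Y zero)    = refl
exchange⁻¹-exchange (suc r) (X (suc i)) =
  trans (exchange⁻¹-shift r (exchange r (X i))) (cong shift (exchange⁻¹-exchange r (X i)))
exchange⁻¹-exchange (suc r) (Y (suc j)) =
  trans (exchange⁻¹-shift r (exchange r (Y j))) (cong shift (exchange⁻¹-exchange r (Y j)))

exchange-exchange⁻¹ : ∀ r l → exchange r (exchange⁻¹ r l) ≡ l
exchange-exchange⁻¹ zero    (X i)       = refl
exchange-exchange⁻¹ zero    (Y zero)    = refl
exchange-exchange⁻¹ zero    (Y (suc j)) = refl
exchange-exchange⁻¹ (suc r) (X zero)    = refl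
exchange-exchange⁻¹ (suc r) (Y zero)    = refl
exchange-exchange⁻¹ (suc r) (X (suc i)) =
  trans (exchange-shift r (exchange⁻¹ r (X i))) (cong shift (exchange-exchange⁻¹ r (X i)))
exchange-exchange⁻¹ (suc r) (Y (suc j)) =
  trans (exchange-shift r (exchange⁻¹ r (Y j))) (cong shift (exchange-exchange⁻¹ r (Y j)))

exchange-X≤ : ∀ {r i} → i ≤ r → exchange r (X i) ≡ Y i
exchange-X≤ {zero}  {zero}  _         = refl
exchange-X≤ {suc r} {zero}  _         = refl
exchange-X≤ {suc r} {suc i} (s≤s i≤r) = cong shift (exchange-X≤ i≤r)

exchange-X> : ∀ {r i} → r ≤ i → exchange r (X (suc i)) ≡ X i
exchange-X> {zero}  _         = refl
exchange-X> {suc r} (s≤s r≤i) = cong shift (exchange-X> r≤i)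

exchange-Y< : ∀ {r j} → j < r → exchange r (Y j) ≡ X j
exchange-Y< {suc r} {zero}  _         = refl
exchange-Y< {suc r} {suc j} (s≤s j<r) = cong shift (exchange-Y< j<r)

exchange-Y≥ : ∀ {r j} → r ≤ j → exchange r (Y j) ≡ Y (suc j)
exchange-Y≥ {zero}  _         = refl
exchange-Y≥ {suc r} (s≤s r≤j) = cong shift (exchange-Y≥ r≤j)

exchange⁻¹-X< : ∀ {r i} → i < r → exchange⁻¹ r (X i) ≡ Y i
exchange⁻¹-X< {suc r} {zero}  _         = refl
exchange⁻¹-X< {suc r} {suc i} (s≤s i<r) = cong shift (exchange⁻¹-X< i<r)

exchange⁻¹-X≥ : ∀ {r i} → r ≤ i → exchange⁻¹ r (X i) ≡ X (suc i)
exchange⁻¹-X≥ {zero}  _         = refl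
exchange⁻¹-X≥ {suc r} (s≤s r≤i) = cong shift (exchange⁻¹-X≥ r≤i)

exchange⁻¹-Y≤ : ∀ {r j} → j ≤ r → exchange⁻¹ r (Y j) ≡ X j
exchange⁻¹-Y≤ {zero}  {zero}  _         = refl
exchange⁻¹-Y≤ {suc r} {zero}  _         = refl
exchange⁻¹-Y≤ {suc r} {suc j} (s≤s j≤r) = cong shift (exchange⁻¹-Y≤ j≤r)

exchange⁻¹-Y> : ∀ {r j} → r ≤ j → exchange⁻¹ r (Y (suc j)) ≡ Y j
exchange⁻¹-Y> {zero}  _         = refl
exchange⁻¹-Y> {suc r} (s≤s r≤j) = cong shift (exchange⁻¹-Y> r≤j)

OnLegs-shift : ∀ {a b} l → OnLegs a b l → OnLegs (suc a) (suc b) (shift l)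
OnLegs-shift (X i) = s≤s
OnLegs-shift (Y j) = s≤s

OnLegs-exchange : ∀ {r a b} → r ≤ a → a ≤ b → ∀ l → OnLegs (suc a) b l → OnLegs a (suc b) (exchange r l)
OnLegs-exchange {zero}          _         _         (X zero)    _         = s≤s z≤n
OnLegs-exchange {zero}          _         _         (X (suc i)) (s≤s i<a) = i<a
OnLegs-exchange {zero}          _         _         (Y j)       j<b       = s≤s j<b
OnLegs-exchange {suc r}         _         (s≤s _)   (X zero)    _         = s≤s z≤n
OnLegs-exchange {suc r}         _         (s≤s _)   (Y zero)    _         = s≤s z≤n
OnLegs-exchange {suc r} {suc a} (s≤s r≤a) (s≤s a≤b) (X (suc i)) (s≤s i<a) =
  OnLegs-shift (exchange r (X i)) (OnLegs-exchange r≤a a≤b (X i) i<a)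
OnLegs-exchange {suc r} {suc a} (s≤s r≤a) (s≤s a≤b) (Y (suc j)) (s≤s j<b) =
  OnLegs-shift (exchange r (Y j)) (OnLegs-exchange r≤a a≤b (Y j) j<b)

OnLegs-exchange⁻¹ : ∀ {r a b} → r ≤ a → a ≤ b → ∀ l → OnLegs a (suc b) l → OnLegs (suc a) b (exchange⁻¹ r l)
OnLegs-exchange⁻¹ {zero}          _         _         (X i)       i<a       = s≤s i<a
OnLegs-exchange⁻¹ {zero}          _         _         (Y zero)    _         = s≤s z≤n
OnLegs-exchange⁻¹ {zero}          _         _         (Y (suc j)) (s≤s j<b) = j<b
OnLegs-exchange⁻¹ {suc r}         _         (s≤s _)   (X zero)    _         = s≤s z≤n
OnLegs-exchange⁻¹ {suc r}         _         (s≤s _)   (Y zero)    _         = s≤s z≤n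
OnLegs-exchange⁻¹ {suc r} {suc a} (s≤s r≤a) (s≤s a≤b) (X (suc i)) (s≤s i<a) =
  OnLegs-shift (exchange⁻¹ r (X i)) (OnLegs-exchange⁻¹ r≤a a≤b (X i) i<a)
OnLegs-exchange⁻¹ {suc r} {suc a} (s≤s r≤a) (s≤s a≤b) (Y (suc j)) (s≤s j<b) =
  OnLegs-shift (exchange⁻¹ r (Y j)) (OnLegs-exchange⁻¹ r≤a a≤b (Y j) j<b)

OffSeam : ℕ → Vertex → Set
OffSeam r w = w ≢ leg (X (suc r)) × w ≢ leg (Y r)

OffSeam-shift : ∀ {r l} → OffSeam (suc r) (leg (shift l)) → OffSeam r (leg l)
OffSeam-shift {l = X i} (offX , _) = (λ { refl → offX refl }) , λ ()
OffSeam-shift {l = Y j} (_ , offY) = (λ ()) , λ { refl → offY refl }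

isX₀ isY₀ : Leg → Bool
isX₀ (X zero) = true
isX₀ _        = false
isY₀ (Y zero) = true
isY₀ _        = false

nextToCentre≡isX₀∨isY₀ : ∀ l → nextToCentre l ≡ isX₀ l ∨ isY₀ l
nextToCentre≡isX₀∨isY₀ (X zero)    = refl
nextToCentre≡isX₀∨isY₀ (X (suc i)) = refl
nextToCentre≡isX₀∨isY₀ (Y zero)    = refl
nextToCentre≡isX₀∨isY₀ (Y (suc j)) = refl

isX₀-shift : ∀ l → isX₀ (shift l) ≡ false
isX₀-shift (X i) = refl
isX₀-shift (Y j) = refl

isY₀-shift : ∀ l → isY₀ (shift l) ≡ false
isY₀-shift (X i) = refl
isY₀-shift (Y j) = refl

adjLeg-shift : ∀ l l′ → adjLeg (shift l) (shift l′) ≡ adjLeg l l′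
adjLeg-shift (X i) (X j) = refl
adjLeg-shift (X i) (Y j) = refl
adjLeg-shift (Y i) (X j) = refl
adjLeg-shift (Y i) (Y j) = refl

adjLeg-X₀-shift : ∀ l → adjLeg (X zero) (shift l) ≡ isX₀ l
adjLeg-X₀-shift (X zero)    = refl
adjLeg-X₀-shift (X (suc i)) = refl
adjLeg-X₀-shift (Y j)       = refl

adjLeg-Y₀-shift : ∀ l → adjLeg (Y zero) (shift l) ≡ isY₀ l
adjLeg-Y₀-shift (X i)       = refl
adjLeg-Y₀-shift (Y zero)    = refl
adjLeg-Y₀-shift (Y (suc j)) = refl

isY₀-exchange : ∀ r l → isY₀ (exchange r l) ≡ isX₀ l
isY₀-exchange zero    (X zero)    = refl
isY₀-exchange zero    (X (suc i)) = refl
isY₀-exchange zero    (Y j)       = refl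
isY₀-exchange (suc r) (X zero)    = refl
isY₀-exchange (suc r) (Y zero)    = refl
isY₀-exchange (suc r) (X (suc i)) = isY₀-shift (exchange r (X i))
isY₀-exchange (suc r) (Y (suc j)) = isY₀-shift (exchange r (Y j))

isX₀-exchange : ∀ r l → OffSeam r (leg l) → isX₀ (exchange r l) ≡ isY₀ l
isX₀-exchange zero    (X (suc zero)) (offX , _) = ⊥-elim (offX refl)
isX₀-exchange zero    (Y zero)       (_ , offY) = ⊥-elim (offY refl)
isX₀-exchange zero    (X zero)       _ = refl
isX₀-exchange zero    (X (suc (suc i))) _ = refl
isX₀-exchange zero    (Y (suc j))    _ = refl
isX₀-exchange (suc r) (X zero)       _ = refl
isX₀-exchange (suc r) (Y zero)       _ = refl
isX₀-exchange (suc r) (X (suc i))    _ = isX₀-shift (exchange r (X i))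
isX₀-exchange (suc r) (Y (suc j))    _ = isX₀-shift (exchange r (Y j))

nextToCentre-exchange : ∀ r l → OffSeam r (leg l) → nextToCentre (exchange r l) ≡ nextToCentre l
nextToCentre-exchange r l off = begin
  nextToCentre (exchange r l)               ≡⟨ nextToCentre≡isX₀∨isY₀ (exchange r l) ⟩
  isX₀ (exchange r l) ∨ isY₀ (exchange r l) ≡⟨ cong₂ _∨_ (isX₀-exchange r l off) (isY₀-exchange r l) ⟩
  isY₀ l ∨ isX₀ l                           ≡⟨ ∨-comm (isY₀ l) (isX₀ l) ⟩
  isX₀ l ∨ isY₀ l                           ≡⟨ nextToCentre≡isX₀∨isY₀ l ⟨
  nextToCentre l                            ∎
  where open ≡-Reasoning

exchange₀-adjLeg : ∀ l l′ → OffSeam 0 (leg l) → OffSeam 0 (leg l′) →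
                   adjLeg (exchange 0 l) (exchange 0 l′) ≡ adjLeg l l′
exchange₀-adjLeg (X (suc zero)) _ (offX , _) _ = ⊥-elim (offX refl)
exchange₀-adjLeg (Y zero)       _ (_ , offY) _ = ⊥-elim (offY refl)
exchange₀-adjLeg _ (X (suc zero)) _ (offX , _) = ⊥-elim (offX refl)
exchange₀-adjLeg _ (Y zero)       _ (_ , offY) = ⊥-elim (offY refl)
exchange₀-adjLeg (X zero)          (X zero)          _ _ = refl
exchange₀-adjLeg (X zero)          (X (suc (suc i))) _ _ = refl
exchange₀-adjLeg (X zero)          (Y (suc j))       _ _ = refl
exchange₀-adjLeg (X (suc (suc i))) (X zero)          _ _ = refl
exchange₀-adjLeg (X (suc (suc i))) (X (suc (suc j))) _ _ = refl
exchange₀-adjLeg (X (suc (suc i))) (Y (suc j))       _ _ = refl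
exchange₀-adjLeg (Y (suc i))       (X zero)          _ _ = refl
exchange₀-adjLeg (Y (suc i))       (X (suc (suc j))) _ _ = refl
exchange₀-adjLeg (Y (suc i))       (Y (suc j))       _ _ = refl

data LegView : Leg → Set where
  firstX : LegView (X zero)
  firstY : LegView (Y zero)
  next   : ∀ l → LegView (shift l)

legView : ∀ l → LegView l
legView (X zero)    = firstX
legView (Y zero)    = firstY
legView (X (suc i)) = next (X i)
legView (Y (suc j)) = next (Y j)

exchange-adjLeg-X₀ : ∀ r l → adjLeg (exchange (suc r) (X zero)) (exchange (suc r) (shift l)) ≡ adjLeg (X zero) (shift l)
exchange-adjLeg-X₀ r l = begin
  adjLeg (Y zero) (exchange (suc r) (shift l)) ≡⟨ cong (adjLeg (Y zero)) (exchange-shift r l) ⟩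
  adjLeg (Y zero) (shift (exchange r l))       ≡⟨ adjLeg-Y₀-shift (exchange r l) ⟩
  isY₀ (exchange r l)                          ≡⟨ isY₀-exchange r l ⟩
  isX₀ l                                       ≡⟨ adjLeg-X₀-shift l ⟨
  adjLeg (X zero) (shift l)                    ∎
  where open ≡-Reasoning

exchange-adjLeg-Y₀ : ∀ r l → OffSeam r (leg l) →
                     adjLeg (exchange (suc r) (Y zero)) (exchange (suc r) (shift l)) ≡ adjLeg (Y zero) (shift l)
exchange-adjLeg-Y₀ r l off = begin
  adjLeg (X zero) (exchange (suc r) (shift l)) ≡⟨ cong (adjLeg (X zero)) (exchange-shift r l) ⟩
  adjLeg (X zero) (shift (exchange r l))       ≡⟨ adjLeg-X₀-shift (exchange r l) ⟩
  isX₀ (exchange r l)                          ≡⟨ isX₀-exchange r l off ⟩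
  isY₀ l                                       ≡⟨ adjLeg-Y₀-shift l ⟨
  adjLeg (Y zero) (shift l)                    ∎
  where open ≡-Reasoning

exchange-adjLeg : ∀ r l l′ → OffSeam r (leg l) → OffSeam r (leg l′) →
                  adjLeg (exchange r l) (exchange r l′) ≡ adjLeg l l′
exchange-adjLeg zero    l l′ off off′ = exchange₀-adjLeg l l′ off off′
exchange-adjLeg (suc r) l l′ off off′ with legView l | legView l′
... | firstX | firstX = refl
... | firstX | firstY = refl
... | firstY | firstX = refl
... | firstY | firstY = refl
... | firstX | next m = exchange-adjLeg-X₀ r m
... | firstY | next m = exchange-adjLeg-Y₀ r m (OffSeam-shift off′)
... | next m | firstX = adjLeg-flip _ (exchange (suc r) (shift m)) (X zero) (shift m) (exchange-adjLeg-X₀ r m)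
... | next m | firstY =
  adjLeg-flip _ (exchange (suc r) (shift m)) (Y zero) (shift m) (exchange-adjLeg-Y₀ r m (OffSeam-shift off))
... | next m | next m′ = begin
  adjLeg (exchange (suc r) (shift m)) (exchange (suc r) (shift m′))
    ≡⟨ cong₂ adjLeg (exchange-shift r m) (exchange-shift r m′) ⟩
  adjLeg (shift (exchange r m)) (shift (exchange r m′))
    ≡⟨ adjLeg-shift (exchange r m) (exchange r m′) ⟩
  adjLeg (exchange r m) (exchange r m′)
    ≡⟨ exchange-adjLeg r m m′ (OffSeam-shift off) (OffSeam-shift off′) ⟩
  adjLeg m m′
    ≡⟨ adjLeg-shift m m′ ⟨
  adjLeg (shift m) (shift m′) ∎
  where open ≡-Reasoning

rotate : Vertex → Vertex
rotate centre           = leg (Y zero)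
rotate leaf             = leaf
rotate (leg (X zero))    = centre
rotate (leg (X (suc i))) = leg (X i)
rotate (leg (Y j))       = leg (Y (suc j))

rotate⁻¹ : Vertex → Vertex
rotate⁻¹ centre           = leg (X zero)
rotate⁻¹ leaf             = leaf
rotate⁻¹ (leg (X i))       = leg (X (suc i))
rotate⁻¹ (leg (Y zero))    = centre
rotate⁻¹ (leg (Y (suc j))) = leg (Y j)

relabel : Maybe ℕ → Vertex → Vertex
relabel (just r) (leg l) = leg (exchange r l)
relabel (just r) w       = w
relabel nothing  w       = rotate w

relabel⁻¹ : Maybe ℕ → Vertex → Vertex
relabel⁻¹ (just r) (leg l) = leg (exchange⁻¹ r l)
relabel⁻¹ (just r) w       = w
relabel⁻¹ nothing  w       = rotate⁻¹ w

relabel⁻¹-relabel : ∀ s w → relabel⁻¹ s (relabel s w) ≡ w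
relabel⁻¹-relabel (just r) centre           = refl
relabel⁻¹-relabel (just r) leaf             = refl
relabel⁻¹-relabel (just r) (leg l)          = cong leg (exchange⁻¹-exchange r l)
relabel⁻¹-relabel nothing  centre           = refl
relabel⁻¹-relabel nothing  leaf             = refl
relabel⁻¹-relabel nothing  (leg (X zero))    = refl
relabel⁻¹-relabel nothing  (leg (X (suc i))) = refl
relabel⁻¹-relabel nothing  (leg (Y j))       = refl

relabel-relabel⁻¹ : ∀ s w → relabel s (relabel⁻¹ s w) ≡ w
relabel-relabel⁻¹ (just r) centre           = refl
relabel-relabel⁻¹ (just r) leaf             = refl
relabel-relabel⁻¹ (just r) (leg l)          = cong leg (exchange-exchange⁻¹ r l)
relabel-relabel⁻¹ nothing  centre           = refl
relabel-relabel⁻¹ nothing  leaf             = refl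
relabel-relabel⁻¹ nothing  (leg (X i))       = refl
relabel-relabel⁻¹ nothing  (leg (Y zero))    = refl
relabel-relabel⁻¹ nothing  (leg (Y (suc j))) = refl

exchange-adjVertex : ∀ r w w′ → OffSeam r w → OffSeam r w′ →
                     adjVertex (relabel (just r) w) (relabel (just r) w′) ≡ adjVertex w w′
exchange-adjVertex r centre  centre   _   _    = refl
exchange-adjVertex r centre  leaf     _   _    = refl
exchange-adjVertex r centre  (leg l′) _   off′ = nextToCentre-exchange r l′ off′
exchange-adjVertex r leaf    centre   _   _    = refl
exchange-adjVertex r leaf    leaf     _   _    = refl
exchange-adjVertex r leaf    (leg l′) _   _    = refl
exchange-adjVertex r (leg l) centre   off _    = nextToCentre-exchange r l off
exchange-adjVertex r (leg l) leaf     _   _    = refl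
exchange-adjVertex r (leg l) (leg l′) off off′ = exchange-adjLeg r l l′ off off′

LeafAndHub : Vertex → Vertex → Set
LeafAndHub w w′ = w ≡ leaf × (w′ ≡ centre ⊎ w′ ≡ leg (X zero))

rotate-adjVertex : ∀ w w′ → ¬ LeafAndHub w w′ → ¬ LeafAndHub w′ w →
                   adjVertex (rotate w) (rotate w′) ≡ adjVertex w w′
rotate-adjVertex leaf centre          ¬lh _  = ⊥-elim (¬lh (refl , inj₁ refl))
rotate-adjVertex leaf (leg (X zero))  ¬lh _  = ⊥-elim (¬lh (refl , inj₂ refl))
rotate-adjVertex centre leaf          _  ¬lh = ⊥-elim (¬lh (refl , inj₁ refl))
rotate-adjVertex (leg (X zero)) leaf  _  ¬lh = ⊥-elim (¬lh (refl , inj₂ refl))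
rotate-adjVertex leaf leaf                         _ _ = refl
rotate-adjVertex leaf (leg (X (suc i)))            _ _ = refl
rotate-adjVertex leaf (leg (Y j))                  _ _ = refl
rotate-adjVertex (leg (X (suc i))) leaf            _ _ = refl
rotate-adjVertex (leg (Y j)) leaf                  _ _ = refl
rotate-adjVertex centre centre                     _ _ = refl
rotate-adjVertex centre (leg (X zero))             _ _ = refl
rotate-adjVertex centre (leg (X (suc i)))          _ _ = refl
rotate-adjVertex centre (leg (Y zero))             _ _ = refl
rotate-adjVertex centre (leg (Y (suc j)))          _ _ = refl
rotate-adjVertex (leg (X zero)) centre             _ _ = refl
rotate-adjVertex (leg (X (suc i))) centre          _ _ = refl
rotate-adjVertex (leg (Y zero)) centre             _ _ = refl
rotate-adjVertex (leg (Y (suc j))) centre          _ _ = refl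
rotate-adjVertex (leg (X zero)) (leg (X zero))     _ _ = refl
rotate-adjVertex (leg (X zero)) (leg (X (suc zero))) _ _ = refl
rotate-adjVertex (leg (X zero)) (leg (X (suc (suc i)))) _ _ = refl
rotate-adjVertex (leg (X (suc zero))) (leg (X zero)) _ _ = refl
rotate-adjVertex (leg (X (suc (suc i)))) (leg (X zero)) _ _ = refl
rotate-adjVertex (leg (X zero)) (leg (Y j))        _ _ = refl
rotate-adjVertex (leg (Y j)) (leg (X zero))        _ _ = refl
rotate-adjVertex (leg (X (suc i))) (leg (X (suc j))) _ _ = refl
rotate-adjVertex (leg (X (suc i))) (leg (Y j))     _ _ = refl
rotate-adjVertex (leg (Y i)) (leg (X (suc j)))     _ _ = refl
rotate-adjVertex (leg (Y i)) (leg (Y j))           _ _ = refl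

InTree-rotate : ∀ {a b} w → InTree (suc a) b w → InTree a (suc b) (rotate w)
InTree-rotate centre            _         = s≤s z≤n
InTree-rotate leaf              _         = tt
InTree-rotate (leg (X zero))    _         = tt
InTree-rotate (leg (X (suc i))) (s≤s i<a) = i<a
InTree-rotate (leg (Y j))       j<b       = s≤s j<b

InTree-rotate⁻¹ : ∀ {a b} w → InTree a (suc b) w → InTree (suc a) b (rotate⁻¹ w)
InTree-rotate⁻¹ centre            _         = s≤s z≤n
InTree-rotate⁻¹ leaf              _         = tt
InTree-rotate⁻¹ (leg (X i))       i<a       = s≤s i<a
InTree-rotate⁻¹ (leg (Y zero))    _         = tt
InTree-rotate⁻¹ (leg (Y (suc j))) (s≤s j<b) = j<b

InTree-relabel : ∀ {a b s} → All (_≤ a) s → a ≤ b → ∀ w → InTree (suc a) b w → InTree a (suc b) (relabel s w)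
InTree-relabel (just r≤a) a≤b centre  _   = tt
InTree-relabel (just r≤a) a≤b leaf    _   = tt
InTree-relabel (just r≤a) a≤b (leg l) l∈  = OnLegs-exchange r≤a a≤b l l∈
InTree-relabel nothing    _   w       w∈  = InTree-rotate w w∈

InTree-relabel⁻¹ : ∀ {a b s} → All (_≤ a) s → a ≤ b → ∀ w → InTree a (suc b) w → InTree (suc a) b (relabel⁻¹ s w)
InTree-relabel⁻¹ (just r≤a) a≤b centre  _   = tt
InTree-relabel⁻¹ (just r≤a) a≤b leaf    _   = tt
InTree-relabel⁻¹ (just r≤a) a≤b (leg l) l∈  = OnLegs-exchange⁻¹ r≤a a≤b l l∈
InTree-relabel⁻¹ nothing    _   w       w∈  = InTree-rotate⁻¹ w w∈

inTree? : ∀ a b w → Dec (InTree a b w)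
inTree? a b centre      = yes tt
inTree? a b leaf        = yes tt
inTree? a b (leg (X i)) = i <? a
inTree? a b (leg (Y j)) = j <? b

-- Vertices outside T_{a,b} are never members: their codes may collide with codes of tree vertices.
member : ∀ a b {k} → Sub (a + b + 2) k → Vertex → Bool
member a b β w = does (inTree? a b w) ∧ β ∋ᵇ encode a w

module _ (a b : ℕ) {k} (β : Sub (a + b + 2) k) where

  member-inTree : ∀ w → InTree a b w → member a b β w ≡ β ∋ᵇ encode a w
  member-inTree w w∈ = cong (_∧ β ∋ᵇ encode a w) (dec-true (inTree? a b w) w∈)

  member-outside : ∀ w → ¬ InTree a b w → member a b β w ≡ false
  member-outside w w∉ = cong (_∧ β ∋ᵇ encode a w) (dec-false (inTree? a b w) w∉)

  member⇒inTree : ∀ w → member a b β w ≡ true → InTree a b w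
  member⇒inTree w w∈β with inTree? a b w
  ... | yes w∈ = w∈

  member⇒∋ᵇ : ∀ w → member a b β w ≡ true → β ∋ᵇ encode a w ≡ true
  member⇒∋ᵇ w w∈β = trans (sym (member-inTree w (member⇒inTree w w∈β))) w∈β

  ∋ᵇ⇒member : ∀ {u} → β ∋ᵇ u ≡ true → member a b β (decode a u) ≡ true
  ∋ᵇ⇒member {u} u∈β = begin
    member a b β (decode a u)     ≡⟨ member-inTree (decode a u) (decode-InTree a b (∋ᵇ⇒< β u u∈β)) ⟩
    β ∋ᵇ encode a (decode a u)    ≡⟨ cong (β ∋ᵇ_) (encode-decode a u) ⟩
    β ∋ᵇ u                        ≡⟨ u∈β ⟩
    true                          ∎
    where open ≡-Reasoning

  treeMembers⇒≤ : ∀ {p} (ws : Fin p → Vertex) → Injective _≡_ _≡_ ws →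
              (∀ i → member a b β (ws i) ≡ true) → p ≤ k
  treeMembers⇒≤ ws ws-injective ∈β = members⇒≤ β (encode a ∘ ws) encode-injective (λ i → member⇒∋ᵇ (ws i) (∈β i))
    where
    encode-injective : Injective _≡_ _≡_ (encode a ∘ ws)
    encode-injective {i} {j} same = ws-injective (begin
      ws i                        ≡⟨ decode-encode {b = b} (ws i) (member⇒inTree (ws i) (∈β i)) ⟨
      decode a (encode a (ws i))  ≡⟨ cong (decode a) same ⟩
      decode a (encode a (ws j))  ≡⟨ decode-encode {b = b} (ws j) (member⇒inTree (ws j) (∈β j)) ⟩
      ws j                        ∎)
      where open ≡-Reasoning

module TreeRelabelling {a b a′ b′} (f f⁻¹ : Vertex → Vertex)
  (f⁻¹-f : ∀ w → f⁻¹ (f w) ≡ w) (f-f⁻¹ : ∀ w → f (f⁻¹ w) ≡ w)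
  (f-inTree : ∀ w → InTree a b w → InTree a′ b′ (f w))
  (f⁻¹-inTree : ∀ w → InTree a′ b′ w → InTree a b (f⁻¹ w)) where

  relabelling : Relabelling (a + b + 2) (a′ + b′ + 2)
  relabelling = record
    { to      = λ u → encode a′ (f (decode a u))
    ; from    = λ v → encode a (f⁻¹ (decode a′ v))
    ; to-<    = λ {u} u< → encode-< a′ b′ (f (decode a u)) (f-inTree _ (decode-InTree a b u<))
    ; from-<  = λ {v} v< → encode-< a b (f⁻¹ (decode a′ v)) (f⁻¹-inTree _ (decode-InTree a′ b′ v<))
    ; from-to = λ {u} u< → begin
        encode a (f⁻¹ (decode a′ (encode a′ (f (decode a u)))))
          ≡⟨ cong (encode a ∘ f⁻¹) (decode-encode (f (decode a u)) (f-inTree _ (decode-InTree a b u<))) ⟩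
        encode a (f⁻¹ (f (decode a u)))  ≡⟨ cong (encode a) (f⁻¹-f (decode a u)) ⟩
        encode a (decode a u)            ≡⟨ encode-decode a u ⟩
        u                                ∎
    ; to-from = λ {v} v< → begin
        encode a′ (f (decode a (encode a (f⁻¹ (decode a′ v)))))
          ≡⟨ cong (encode a′ ∘ f) (decode-encode (f⁻¹ (decode a′ v)) (f⁻¹-inTree _ (decode-InTree a′ b′ v<))) ⟩
        encode a′ (f (f⁻¹ (decode a′ v)))  ≡⟨ cong (encode a′) (f-f⁻¹ (decode a′ v)) ⟩
        encode a′ (decode a′ v)            ≡⟨ encode-decode a′ v ⟩
        v                                  ∎
    }
    where open ≡-Reasoning

  open Relabelling relabelling

  member-image : ∀ {k} (β : Sub (a + b + 2) k) w → member a′ b′ (image relabelling β) w ≡ member a b β (f⁻¹ w)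
  member-image β w with inTree? a′ b′ w
  ... | no w∉ = sym (member-outside a b β (f⁻¹ w) (w∉ ∘ subst (InTree a′ b′) (f-f⁻¹ w) ∘ f-inTree (f⁻¹ w)))
  ... | yes w∈ = begin
    image relabelling β ∋ᵇ encode a′ w         ≡⟨ ∋ᵇ-image relabelling β (encode-< a′ b′ w w∈) ⟩
    β ∋ᵇ encode a (f⁻¹ (decode a′ (encode a′ w))) ≡⟨ cong (λ x → β ∋ᵇ encode a (f⁻¹ x)) (decode-encode w w∈) ⟩
    β ∋ᵇ encode a (f⁻¹ w)                     ≡⟨ member-inTree a b β (f⁻¹ w) (f⁻¹-inTree w w∈) ⟨
    member a b β (f⁻¹ w)                      ∎
    where open ≡-Reasoning

  member-image⁻¹ : ∀ {k} (χ : Sub (a′ + b′ + 2) k) w →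
                   member a b (image (inverse relabelling) χ) w ≡ member a′ b′ χ (f w)
  member-image⁻¹ χ w with inTree? a b w
  ... | no w∉ = sym (member-outside a′ b′ χ (f w) (w∉ ∘ subst (InTree a b) (f⁻¹-f w) ∘ f⁻¹-inTree (f w)))
  ... | yes w∈ = begin
    image (inverse relabelling) χ ∋ᵇ encode a w ≡⟨ ∋ᵇ-image (inverse relabelling) χ (encode-< a b w w∈) ⟩
    χ ∋ᵇ encode a′ (f (decode a (encode a w)))  ≡⟨ cong (λ x → χ ∋ᵇ encode a′ (f x)) (decode-encode w w∈) ⟩
    χ ∋ᵇ encode a′ (f w)                        ≡⟨ member-inTree a′ b′ χ (f w) (f-inTree w w∈) ⟨
    member a′ b′ χ (f w)                        ∎
    where open ≡-Reasoning

  adjacency-preserved : ∀ {k} (β : Sub (a + b + 2) k) →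
    (∀ {w w′} → member a b β w ≡ true → member a b β w′ ≡ true → adjVertex (f w) (f w′) ≡ adjVertex w w′) →
    ∀ {u u′} → β ∋ᵇ u ≡ true → β ∋ᵇ u′ ≡ true → adjℕ (tEdges a b) u u′ ≡ adjℕ (tEdges a′ b′) (to u) (to u′)
  adjacency-preserved β preserves {u} {u′} u∈β u′∈β = begin
    adjℕ (tEdges a b) u u′
      ≡⟨ cong₂ (adjℕ (tEdges a b)) (encode-decode a u) (encode-decode a u′) ⟨
    adjℕ (tEdges a b) (encode a w) (encode a w′)
      ≡⟨ T-adjacency w w′ (inTree u u∈β) (inTree u′ u′∈β) ⟩
    adjVertex w w′
      ≡⟨ preserves (∋ᵇ⇒member a b β u∈β) (∋ᵇ⇒member a b β u′∈β) ⟨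
    adjVertex (f w) (f w′)
      ≡⟨ T-adjacency (f w) (f w′) (f-inTree w (inTree u u∈β)) (f-inTree w′ (inTree u′ u′∈β)) ⟨
    adjℕ (tEdges a′ b′) (to u) (to u′) ∎
    where
    open ≡-Reasoning
    w  = decode a u
    w′ = decode a u′
    inTree : ∀ x → β ∋ᵇ x ≡ true → InTree a b (decode a x)
    inTree x x∈β = decode-InTree a b (∋ᵇ⇒< β x x∈β)

leastUpTo : ∀ a → (ℕ → Bool) → Maybe (Fin (suc a))
leastUpTo zero    t = if t 0 then just zero else nothing
leastUpTo (suc a) t = if t 0 then just zero else Maybe.map suc (leastUpTo a (t ∘ suc))

leastUpTo-bound : ∀ a → Maybe (Fin (suc a)) → ℕ
leastUpTo-bound a = maybe′ toℕ a

leastUpTo-just : ∀ a t {r} → leastUpTo a t ≡ just r → t (toℕ r) ≡ true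
leastUpTo-just zero    t found with t 0 in t0
leastUpTo-just zero    t refl | true = t0
leastUpTo-just (suc a) t found with t 0 in t0
leastUpTo-just (suc a) t refl | true = t0
... | false with leastUpTo a (t ∘ suc) in rest
leastUpTo-just (suc a) t refl | false | just r = leastUpTo-just a (t ∘ suc) rest

leastUpTo-nothing : ∀ a t → leastUpTo a t ≡ nothing → ∀ r → r ≤ a → t r ≡ false
leastUpTo-nothing zero    t none zero _ with t 0
... | false = refl
leastUpTo-nothing (suc a) t none r r≤ with t 0 in t0
... | false with leastUpTo a (t ∘ suc) in rest
leastUpTo-nothing (suc a) t refl zero    _         | false | nothing = t0
leastUpTo-nothing (suc a) t refl (suc r) (s≤s r≤a) | false | nothing = leastUpTo-nothing a (t ∘ suc) rest r r≤a

leastUpTo-cong : ∀ a t₁ t₂ → (∀ r → r ≤ leastUpTo-bound a (leastUpTo a t₂) → t₁ r ≡ t₂ r) →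
                 leastUpTo a t₁ ≡ leastUpTo a t₂
leastUpTo-cong zero    t₁ t₂ agree with t₂ 0 in t0
... | true  rewrite agree 0 z≤n | t0 = refl
... | false rewrite agree 0 z≤n | t0 = refl
leastUpTo-cong (suc a) t₁ t₂ agree with t₂ 0 in t0
... | true  rewrite agree 0 z≤n | t0 = refl
... | false rewrite agree 0 z≤n | t0 =
  cong (Maybe.map suc) (leastUpTo-cong a (t₁ ∘ suc) (t₂ ∘ suc) λ r r≤ →
    agree (suc r) (subst (suc r ≤_) (sym (bound-suc (leastUpTo a (t₂ ∘ suc)))) (s≤s r≤)))
  where
  bound-suc : ∀ s → leastUpTo-bound (suc a) (Maybe.map suc s) ≡ suc (leastUpTo-bound a s)
  bound-suc nothing  = refl
  bound-suc (just r) = refl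

relabel⁻¹-gap : ∀ {s} r → All (r ≤_) s →
  (relabel⁻¹ s (leg (X r)) ≡ leg (Y r) × relabel⁻¹ s (leg (Y (suc r))) ≡ leg (X (suc r))) ⊎
  (relabel⁻¹ s (leg (X r)) ≡ leg (X (suc r)) × relabel⁻¹ s (leg (Y (suc r))) ≡ leg (Y r))
relabel⁻¹-gap r nothing     = inj₂ (refl , refl)
relabel⁻¹-gap r (just r≤r₀) with m≤n⇒m<n∨m≡n r≤r₀
... | inj₁ r<r₀ = inj₁ (cong leg (exchange⁻¹-X< r<r₀) , cong leg (exchange⁻¹-Y≤ r<r₀))
... | inj₂ refl = inj₂ (cong leg (exchange⁻¹-X≥ ≤-refl) , cong leg (exchange⁻¹-Y> ≤-refl))

relabel-gap : ∀ {s} r → All (r ≤_) s →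
  (relabel s (leg (X (suc r))) ≡ leg (Y (suc r)) × relabel s (leg (Y r)) ≡ leg (X r)) ⊎
  (relabel s (leg (X (suc r))) ≡ leg (X r) × relabel s (leg (Y r)) ≡ leg (Y (suc r)))
relabel-gap r nothing     = inj₂ (refl , refl)
relabel-gap r (just r≤r₀) with m≤n⇒m<n∨m≡n r≤r₀
... | inj₁ r<r₀ = inj₁ (cong leg (exchange-X≤ r<r₀) , cong leg (exchange-Y< r<r₀))
... | inj₂ refl = inj₂ (cong leg (exchange-X> ≤-refl) , cong leg (exchange-Y≥ ≤-refl))

member≢ : ∀ {a b k} (β : Sub (a + b + 2) k) {w v} → member a b β w ≡ true → member a b β v ≡ false → w ≢ v
member≢ β w∈β v∉β refl with () ← trans (sym w∈β) v∉β

not∧not≡true : ∀ x y → (not x ∧ not y) ≡ true → x ≡ false × y ≡ false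
not∧not≡true false false _ = refl , refl

not∧not≡false : ∀ x y → (not x ∧ not y) ≡ false → x ≡ false → y ≡ true
not∧not≡false false true _ _ = refl

module EdgeMove (a b k : ℕ) (a≤b : a ≤ b) (k≤2+a : k ≤ 2 + a) where

  H G : ℕ
  H = suc a + b + 2
  G = a + suc b + 2

  level : Maybe (Fin (suc a)) → Maybe ℕ
  level = Maybe.map toℕ

  level-≤ : ∀ s → All (_≤ a) (level s)
  level-≤ nothing  = nothing
  level-≤ (just r) = just (s≤s⁻¹ (toℕ<n r))

  below-bound : ∀ {r} s → r ≤ leastUpTo-bound a s → All (r ≤_) (level s)
  below-bound nothing  _   = nothing
  below-bound (just _) r≤ = just r≤

  module Relabel (s : Maybe (Fin (suc a))) =
    TreeRelabelling (relabel (level s)) (relabel⁻¹ (level s)) (relabel⁻¹-relabel (level s)) (relabel-relabel⁻¹ (level s))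
                    (InTree-relabel (level-≤ s) a≤b) (InTree-relabel⁻¹ (level-≤ s) a≤b)

  absentH : Sub H k → Vertex → Vertex → Bool
  absentH β v v′ = not (member (suc a) b β v) ∧ not (member (suc a) b β v′)

  absentG : Sub G k → Vertex → Vertex → Bool
  absentG χ v v′ = not (member a (suc b) χ v) ∧ not (member a (suc b) χ v′)

  gapH : Sub H k → ℕ → Bool
  gapH β r = absentH β (leg (X (suc r))) (leg (Y r))

  gapG : Sub G k → ℕ → Bool
  gapG χ r = absentG χ (leg (X r)) (leg (Y (suc r)))

  ρH : Sub H k → Maybe (Fin (suc a))
  ρH β = leastUpTo a (gapH β)

  ρG : Sub G k → Maybe (Fin (suc a))
  ρG χ = leastUpTo a (gapG χ)

  ρG-image : ∀ β → ρG (image (Relabel.relabelling (ρH β)) β) ≡ ρH β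
  ρG-image β = leastUpTo-cong a _ _ λ r r≤ →
    trans (cong₂ (λ x y → not x ∧ not y) (member-image β (leg (X r))) (member-image β (leg (Y (suc r)))))
          (gap-agrees r r≤)
    where
    open Relabel (ρH β)
    s : Maybe ℕ
    s = level (ρH β)
    gap-agrees : ∀ r → r ≤ leastUpTo-bound a (ρH β) →
                 absentH β (relabel⁻¹ s (leg (X r))) (relabel⁻¹ s (leg (Y (suc r)))) ≡ gapH β r
    gap-agrees r r≤ with relabel⁻¹-gap r (below-bound (ρH β) r≤)
    ... | inj₁ (eX , eY) = trans (cong₂ (absentH β) eX eY) (∧-comm (not (member (suc a) b β (leg (Y r)))) _)
    ... | inj₂ (eX , eY) = cong₂ (absentH β) eX eY

  ρH-image : ∀ χ → ρH (image (inverse (Relabel.relabelling (ρG χ))) χ) ≡ ρG χ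
  ρH-image χ = leastUpTo-cong a _ _ λ r r≤ →
    trans (cong₂ (λ x y → not x ∧ not y) (member-image⁻¹ χ (leg (X (suc r)))) (member-image⁻¹ χ (leg (Y r))))
          (gap-agrees r r≤)
    where
    open Relabel (ρG χ)
    s : Maybe ℕ
    s = level (ρG χ)
    gap-agrees : ∀ r → r ≤ leastUpTo-bound a (ρG χ) →
                 absentG χ (relabel s (leg (X (suc r)))) (relabel s (leg (Y r))) ≡ gapG χ r
    gap-agrees r r≤ with relabel-gap r (below-bound (ρG χ) r≤)
    ... | inj₁ (eX , eY) = trans (cong₂ (absentG χ) eX eY) (∧-comm (not (member a (suc b) χ (leg (Y (suc r))))) _)
    ... | inj₂ (eX , eY) = cong₂ (absentG χ) eX eY

  module NoGap (β : Sub H k) (noGap : ∀ r → r ≤ a → gapH β r ≡ false) where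

    witness : ℕ → Vertex
    witness r = if member (suc a) b β (leg (X (suc r))) then leg (X (suc r)) else leg (Y r)

    witness-member : ∀ r → r ≤ a → member (suc a) b β (witness r) ≡ true
    witness-member r r≤a with member (suc a) b β (leg (X (suc r))) in eX
    ... | true  = eX
    ... | false = not∧not≡false _ _ (noGap r r≤a) eX

    tag : Vertex → ℕ
    tag leaf              = 0
    tag centre            = 1
    tag (leg (X zero))    = 1
    tag (leg (X (suc i))) = 2 + i
    tag (leg (Y j))       = 2 + j

    tag-hub : ∀ {v} → v ≡ centre ⊎ v ≡ leg (X zero) → tag v ≡ 1
    tag-hub (inj₁ refl) = refl
    tag-hub (inj₂ refl) = refl

    tag-witness : ∀ r → tag (witness r) ≡ 2 + r
    tag-witness r with member (suc a) b β (leg (X (suc r)))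
    ... | true  = refl
    ... | false = refl

    ¬leafAndHub : ∀ {w w′} → member (suc a) b β w ≡ true → member (suc a) b β w′ ≡ true → ¬ LeafAndHub w w′
    ¬leafAndHub {w′ = hub} leaf∈β hub∈β (refl , hub∈) = ≤⇒≯ k≤2+a (treeMembers⇒≤ (suc a) b β ws ws-injective ws∈β)
      where
      ws : Fin (3 + a) → Vertex
      ws zero          = leaf
      ws (suc zero)    = hub
      ws (suc (suc i)) = witness (toℕ i)

      ws∈β : ∀ i → member (suc a) b β (ws i) ≡ true
      ws∈β zero          = leaf∈β
      ws∈β (suc zero)    = hub∈β
      ws∈β (suc (suc i)) = witness-member (toℕ i) (s≤s⁻¹ (toℕ<n i))

      tag-ws : ∀ i → tag (ws i) ≡ toℕ i
      tag-ws zero          = refl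
      tag-ws (suc zero)    = tag-hub hub∈
      tag-ws (suc (suc i)) = tag-witness (toℕ i)

      ws-injective : Injective _≡_ _≡_ ws
      ws-injective {i} {j} same = toℕ-injective (trans (sym (tag-ws i)) (trans (cong tag same) (tag-ws j)))

  relabel-preserves : ∀ β {w w′} → member (suc a) b β w ≡ true → member (suc a) b β w′ ≡ true →
                      adjVertex (relabel (level (ρH β)) w) (relabel (level (ρH β)) w′) ≡ adjVertex w w′
  relabel-preserves β {w} {w′} w∈β w′∈β with ρH β in found
  ... | just r  = exchange-adjVertex (toℕ r) w w′ (offSeam w∈β) (offSeam w′∈β)
    where
    absent : member (suc a) b β (leg (X (suc (toℕ r)))) ≡ false × member (suc a) b β (leg (Y (toℕ r))) ≡ false
    absent = not∧not≡true _ _ (leastUpTo-just a (gapH β) found)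
    offSeam : ∀ {v} → member (suc a) b β v ≡ true → OffSeam (toℕ r) v
    offSeam v∈β = member≢ β v∈β (proj₁ absent) , member≢ β v∈β (proj₂ absent)
  ... | nothing = rotate-adjVertex w w′ (¬leafAndHub w∈β w′∈β) (¬leafAndHub w′∈β w∈β)
    where open NoGap β (leastUpTo-nothing a (gapH β) found)

  sameDeck : SameDeck k (T a (suc b)) (T (suc a) b)
  sameDeck = Switching.sameDeck (λ s → Relabel.relabelling s) ρH ρG ρG-image ρH-image
    (adjℕ (tEdges a (suc b))) (adjℕ (tEdges (suc a) b))
    λ β → Relabel.adjacency-preserved (ρH β) β (relabel-preserves β)

theorem1p6 : (a b k : ℕ) → a < b → k ∸ 2 ≤ a →
    SameDeck k (T a b) (T (a + 1) (b ∸ 1))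
theorem1p6 a (suc b) k (s≤s a≤b) k∸2≤a =
  subst (λ a′ → SameDeck k (T a (suc b)) (T a′ b)) (+-comm 1 a)
        (EdgeMove.sameDeck a b k a≤b (≤-trans (m≤n+m∸n k 2) (+-monoʳ-≤ 2 k∸2≤a)))
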